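{- For every $n\geq 3$, the necklace matroid $N_n$ and the whirl $\mathcal{W}^n$ are isomorphic.
   Context: The necklace $N_n$ is the transversal matroid on $\{1,2,\dots,2n\}$ presented by the cyclic intervals $I_i=\{2i-1,2i,2i+1\}$ for $i=1,\dots,n$ (with $2n+1$ read as $1$, so $I_n=\{2n-1,2n,1\}$): its bases are the sets $\{x_1,\dots,x_n\}$ of $n$ distinct elements with $x_i\in I_i$ for all $i$. The wheel graph $\mathcal{W}_n$ has vertices $c,v_1,\dots,v_n$, an edge labelled $2i-1$ between $v_i$ and $v_{i+1}$ (indices mod $n$) and an edge labelled $2i$ between $c$ and $v_i$, for $i\in[n]$. The whirl $\mathcal{W}^n$ is the matroid on $\{1,\dots,2n\}$ whose bases are the edge sets of spanning trees of $\mathcal{W}_n$ together with the set $\{1,3,\dots,2n-1\}$ of rim edges. -}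

module Defs where

open import Data.Nat using (ℕ; zero; suc; _+_; _*_; _∸_; _≤_; _<_; _≡ᵇ_; _%_)
open import Data.Bool using (if_then_else_)
open import Data.Fin using (Fin; toℕ)
open import Data.Fin.Subset using (Subset; _∈_; _-_; inside; outside)
open import Data.Vec using (tabulate; lookup)
open import Data.Product using (Σ; ∃; _×_)
open import Data.Sum using (_⊎_)
open import Relation.Nullary using (¬_)
open import Relation.Binary.PropositionalEquality using (_≡_)
open import Function.Definitions using (Injective)
open import Function.Bundles using (_↔_; _⇔_; Inverse)

-- Ground set {1,…,2n} is represented by Fin (2 * n); element e has label 1 + toℕ e.
label : {m : ℕ} → Fin m → ℕ
label e = suc (toℕ e)

InInterval : ℕ → ℕ → ℕ → Set
InInterval n i x =
  (x ≡ 2 * i ∸ 1) ⊎ (x ≡ 2 * i) ⊎ ((¬ (i ≡ n) × x ≡ 2 * i + 1) ⊎ (i ≡ n × x ≡ 1))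

NecklaceBasis : (n : ℕ) → Subset (2 * n) → Set
NecklaceBasis n B =
  Σ (Fin n → Fin (2 * n)) λ f →
    Injective _≡_ _≡_ f
    × (∀ i → InInterval n (suc (toℕ i)) (label (f i)))
    × (∀ x → (x ∈ B) ⇔ (∃ λ i → f i ≡ x))

-- Wheel graph W_n: vertices c = 0, v_i = i (1 ≤ i ≤ n).

nextV : ℕ → ℕ → ℕ
nextV n i = if i ≡ᵇ n then 1 else suc i

Joins : ℕ → ℕ → ℕ → ℕ → Set
Joins n ℓ u w =
  (Σ ℕ λ i → 1 ≤ i × i ≤ n × ℓ ≡ 2 * i ∸ 1 × u ≡ i × w ≡ nextV n i)
  ⊎ (Σ ℕ λ i → 1 ≤ i × i ≤ n × ℓ ≡ 2 * i × u ≡ 0 × w ≡ i)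

data Reach (n : ℕ) (T : Subset (2 * n)) : ℕ → ℕ → Set where
  here : ∀ {u} → Reach n T u u
  step : ∀ {u w v} (e : Fin (2 * n)) → e ∈ T →
         (Joins n (label e) u w ⊎ Joins n (label e) w u) →
         Reach n T w v → Reach n T u v

-- T is the edge set of a spanning tree of W_n: the spanning subgraph with
-- edges T is connected and acyclic (no edge of T lies on a cycle, i.e. its
-- endpoints are disconnected once the edge is removed).
SpanningTree : (n : ℕ) → Subset (2 * n) → Set
SpanningTree n T =
  (∀ u v → u ≤ n → v ≤ n → Reach n T u v)
  × (∀ e → e ∈ T → ∀ u w → Joins n (label e) u w → ¬ Reach n (T - e) u w)

-- rim edges {1,3,…,2n-1}: labels odd, i.e. toℕ e even
rim : (n : ℕ) → Subset (2 * n)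
rim n = tabulate λ e → if toℕ e % 2 ≡ᵇ 0 then inside else outside

WhirlBasis : (n : ℕ) → Subset (2 * n) → Set
WhirlBasis n B = SpanningTree n B ⊎ (B ≡ rim n)

image : {m : ℕ} → Fin m ↔ Fin m → Subset m → Subset m
image σ B = tabulate λ y → lookup B (Inverse.from σ y)

NecklaceIsoWhirl : ℕ → Set
NecklaceIsoWhirl n =
  Σ (Fin (2 * n) ↔ Fin (2 * n)) λ σ →
    ∀ B → NecklaceBasis n B ⇔ WhirlBasis n (image σ B)

module Submission where

-- Relabelling the rim edges cyclically by e ↦ e − 2 maps the necklace interval I_i = {2i−1, 2i, 2i+1}
-- onto the star {2i−3, 2i, 2i−1} of the rim vertex v_i, so N_n is isomorphic to the transversal
-- matroid of the stars of the rim vertices, and it remains to see that its bases are those of the whirl.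
-- Picking for every rim vertex a distinct incident edge defines a parent map towards a neighbour or the
-- centre, and distinctness forbids two neighbours from picking the rim edge between them. If some vertex
-- picks its spoke, every chain of parents therefore runs into the centre and the picked edges form a
-- spanning tree; if none does, all picks point the same way round and give the rim. Conversely, a
-- spanning tree rooted at the centre assigns each rim vertex the edge to its parent, and the rim assigns
-- each vertex its forward edge.

open import Defs
open import Data.Bool using (true; false; T; if_then_else_)
open import Data.Empty using (⊥-elim)
open import Data.Fin using (Fin; zero; suc; toℕ; fromℕ<; cast; combine)
open import Data.Fin.Properties
  using (any?; toℕ-injective; toℕ-fromℕ<; toℕ<n; toℕ-cast; toℕ-combine; combine-surjective)
import Data.Fin.Properties as Fin
open import Data.Fin.Subset using (Subset; _∈_; _∉_; _⊆_; _-_; inside; outside)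
open import Data.Fin.Subset.Properties using (p─q⊆p; ⊆-antisym; _∈?_; x∈p∧x≢y⇒x∈p-y)
open import Data.Nat using (ℕ; zero; suc; _+_; _*_; _∸_; _≤_; _<_; z≤n; s≤s; _<?_; _≟_; _≡ᵇ_; _%_)
open import Data.Nat.DivMod using (m*n%n≡0; [m+kn]%n≡m%n)
open import Data.Nat.Properties
open import Data.Product using (∃; _×_; _,_; proj₁; proj₂; swap)
open import Data.Sum using (_⊎_; inj₁; inj₂)
import Data.Sum as Sum
open import Data.Unit using (tt)
open import Data.Vec using (_∷_; there; lookup)
open import Data.Vec.Properties using ([]=⇒lookup; lookup⇒[]=; lookup∘tabulate)
open import Function.Base using (_∘_; case_of_)
open import Function.Bundles using (_↔_; _⇔_; Inverse; Equivalence; mk⇔; mk↔ₛ′)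
open import Function.Construct.Composition using (_⇔-∘_)
open import Function.Definitions using (Injective)
open import Relation.Binary.Definitions using (DecidableEquality)
open import Relation.Binary.PropositionalEquality
open import Relation.Nullary using (¬_; Dec; yes; no; contradiction; _×-dec_)

module _ {A : Set} where
  open import Function.Endo.Propositional A public using (_^_; ^-homo)

module _ {A : Set} (f : A → A) where

  ^-+ : ∀ a b x → (f ^ (a + b)) x ≡ (f ^ a) ((f ^ b) x)
  ^-+ a b x = cong-app (^-homo f a b) x

  ^-comm : ∀ a b x → (f ^ a) ((f ^ b) x) ≡ (f ^ b) ((f ^ a) x)
  ^-comm a b x = trans (sym (^-+ a b x)) (trans (cong (λ k → (f ^ k) x) (+-comm a b)) (^-+ b a x))

  ^-shift : ∀ j x → (f ^ j) (f x) ≡ f ((f ^ j) x)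
  ^-shift j x = ^-comm j 1 x

  ^-fixed : ∀ {x} → f x ≡ x → ∀ j → (f ^ j) x ≡ x
  ^-fixed fx≡x zero    = refl
  ^-fixed fx≡x (suc j) = trans (cong f (^-fixed fx≡x j)) fx≡x

  ^-periodic : ∀ {x} k → (f ^ k) x ≡ x → ∀ q → (f ^ (q * k)) x ≡ x
  ^-periodic k fᵏx≡x zero    = refl
  ^-periodic k fᵏx≡x (suc q) =
    trans (^-+ k (q * k) _) (trans (cong (f ^ k) (^-periodic k fᵏx≡x q)) fᵏx≡x)

  ^-injective : Injective _≡_ _≡_ f → ∀ j → Injective _≡_ _≡_ (f ^ j)
  ^-injective f-inj zero    eq = eq
  ^-injective f-inj (suc j) eq = ^-injective f-inj j (f-inj eq)

y∉p-y : ∀ {N} (p : Subset N) y → y ∉ p - y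
y∉p-y (_ ∷ p) zero    ()
y∉p-y (_ ∷ p) (suc y) (there y∈p-y) = y∉p-y p y y∈p-y

label-injective : ∀ {N} → Injective _≡_ _≡_ (label {N})
label-injective eq = toℕ-injective (suc-injective eq)

∈-image : ∀ {N} (σ : Fin N ↔ Fin N) {B y} → y ∈ image σ B ⇔ Inverse.from σ y ∈ B
∈-image σ {B} {y} = mk⇔
  (λ y∈ → lookup⇒[]= _ B (trans (sym (lookup∘tabulate _ y)) ([]=⇒lookup y∈)))
  (λ y∈ → lookup⇒[]= y _ (trans (lookup∘tabulate _ y) ([]=⇒lookup y∈)))

data Direction : Set where
  left spoke right : Direction

_≟ᵈ_ : DecidableEquality Direction
left  ≟ᵈ left  = yes refl
left  ≟ᵈ spoke = no λ ()
left  ≟ᵈ right = no λ ()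
spoke ≟ᵈ left  = no λ ()
spoke ≟ᵈ spoke = yes refl
spoke ≟ᵈ right = no λ ()
right ≟ᵈ left  = no λ ()
right ≟ᵈ spoke = no λ ()
right ≟ᵈ right = yes refl

record Transversal {I : Set} {N : ℕ} (A : I → Direction → Fin N) (T : Subset N) : Set where
  constructor mkTransversal
  field
    choice           : I → Direction
    chosen-∈         : ∀ i → A i (choice i) ∈ T
    chosen-injective : Injective _≡_ _≡_ (λ i → A i (choice i))
    chosen-onto      : ∀ y → y ∈ T → ∃ λ i → A i (choice i) ≡ y

module _ {N : ℕ} (σ : Fin N ↔ Fin N) where

  open Inverse σ

  transversal-image : ∀ {I : Set} {A A′ : I → Direction → Fin N} {B} →
                      (∀ i d → to (A i d) ≡ A′ i d) → Transversal A B ⇔ Transversal A′ (image σ B)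
  transversal-image {A = A} {A′} {B} σA≡A′ = mk⇔ forth back
    where
    from-A′ : ∀ i d → from (A′ i d) ≡ A i d
    from-A′ i d = trans (cong from (sym (σA≡A′ i d))) (strictlyInverseʳ (A i d))

    forth : Transversal A B → Transversal A′ (image σ B)
    forth (mkTransversal d d-∈ d-inj d-onto) = mkTransversal d
      (λ i → Equivalence.from (∈-image σ) (subst (_∈ B) (sym (from-A′ i (d i))) (d-∈ i)))
      (λ eq → d-inj (trans (sym (from-A′ _ _)) (trans (cong from eq) (from-A′ _ _))))
      (λ y y∈ → let i , eq = d-onto (from y) (Equivalence.to (∈-image σ) y∈)
                in i , trans (sym (σA≡A′ i (d i))) (trans (cong to eq) (strictlyInverseˡ y)))

    back : Transversal A′ (image σ B) → Transversal A B
    back (mkTransversal d d-∈ d-inj d-onto) = mkTransversal d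
      (λ i → subst (_∈ B) (from-A′ i (d i)) (Equivalence.to (∈-image σ) (d-∈ i)))
      (λ eq → d-inj (trans (sym (σA≡A′ _ _)) (trans (cong to eq) (σA≡A′ _ _))))
      (λ y y∈ → let i , eq = d-onto (to y) (Equivalence.from (∈-image σ)
                                                     (subst (_∈ B) (sym (strictlyInverseʳ y)) y∈))
                in i , trans (sym (from-A′ i (d i))) (trans (cong from eq) (strictlyInverseʳ y)))

module _ {n : ℕ} {T : Subset (2 * n)} where

  Reach-trans : ∀ {x y z} → Reach n T x y → Reach n T y z → Reach n T x z
  Reach-trans here               r′ = r′
  Reach-trans (step e e∈T j r) r′ = step e e∈T j (Reach-trans r r′)

  Reach-sym : ∀ {x y} → Reach n T x y → Reach n T y x
  Reach-sym here               = here
  Reach-sym (step e e∈T j r) = Reach-trans (Reach-sym r) (step e e∈T (Sum.swap j) here)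

module Cycle (m : ℕ) where

  n : ℕ
  n = suc m

  next : Fin n → Fin n
  next i with suc (toℕ i) <? n
  ... | yes i+1<n = fromℕ< i+1<n
  ... | no  _     = zero

  toℕ-next : ∀ i → toℕ i < m → toℕ (next i) ≡ suc (toℕ i)
  toℕ-next i i<m with suc (toℕ i) <? n
  ... | yes i+1<n = toℕ-fromℕ< i+1<n
  ... | no  i+1≮n = contradiction (s≤s i<m) i+1≮n

  toℕ<m : ∀ i → toℕ i ≢ m → toℕ i < m
  toℕ<m i i≢m = ≤∧≢⇒< (≤-pred (toℕ<n i)) i≢m

  next-last : ∀ i → toℕ i ≡ m → next i ≡ zero
  next-last i i≡m with suc (toℕ i) <? n
  ... | yes i+1<n = contradiction (cong suc i≡m) (<⇒≢ i+1<n)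
  ... | no  _     = refl

  toℕ-next^-zero : ∀ j → j < n → toℕ ((next ^ j) zero) ≡ j
  toℕ-next^-zero zero    _   = refl
  toℕ-next^-zero (suc j) j<m with toℕ-next^-zero j (<⇒≤ j<m)
  ... | ih = trans (toℕ-next _ (subst (_< m) (sym ih) (≤-pred j<m))) (cong suc ih)

  next^-toℕ : ∀ u → (next ^ toℕ u) zero ≡ u
  next^-toℕ u = toℕ-injective (toℕ-next^-zero (toℕ u) (toℕ<n u))

  next^n-zero : (next ^ n) zero ≡ zero
  next^n-zero = next-last _ (toℕ-next^-zero m ≤-refl)

  next^n : ∀ u → (next ^ n) u ≡ u
  next^n u = begin
    (next ^ n) u                       ≡⟨ cong (next ^ n) (sym (next^-toℕ u)) ⟩
    (next ^ n) ((next ^ toℕ u) zero)   ≡⟨ ^-comm next n (toℕ u) zero ⟩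
    (next ^ toℕ u) ((next ^ n) zero)   ≡⟨ cong (next ^ toℕ u) next^n-zero ⟩
    (next ^ toℕ u) zero                ≡⟨ next^-toℕ u ⟩
    u                                  ∎
    where open ≡-Reasoning

  prev : Fin n → Fin n
  prev = next ^ m

  prev-next : ∀ u → prev (next u) ≡ u
  prev-next u = trans (^-shift next m u) (next^n u)

  next-prev : ∀ u → next (prev u) ≡ u
  next-prev = next^n

  next-injective : Injective _≡_ _≡_ next
  next-injective {u} {w} eq = trans (sym (prev-next u)) (trans (cong prev eq) (prev-next w))

  prev-injective : Injective _≡_ _≡_ prev
  prev-injective {u} {w} eq = trans (sym (next-prev u)) (trans (cong next eq) (next-prev w))

  next-of-prev : ∀ {u w} → u ≡ prev w → next u ≡ w
  next-of-prev {w = w} refl = next-prev w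

  next^-reach-zero : ∀ u → (next ^ (n ∸ toℕ u)) u ≡ zero
  next^-reach-zero u = begin
    (next ^ (n ∸ toℕ u)) u                       ≡⟨ cong (next ^ (n ∸ toℕ u)) (sym (next^-toℕ u)) ⟩
    (next ^ (n ∸ toℕ u)) ((next ^ toℕ u) zero)   ≡⟨ sym (^-+ next (n ∸ toℕ u) (toℕ u) zero) ⟩
    (next ^ (n ∸ toℕ u + toℕ u)) zero            ≡⟨ cong (λ k → (next ^ k) zero)
                                                         (m∸n+n≡m (<⇒≤ (toℕ<n u))) ⟩
    (next ^ n) zero                              ≡⟨ next^n-zero ⟩
    zero                                         ∎
    where open ≡-Reasoning

  next^-reach : ∀ u w → ∃ λ j → (next ^ j) u ≡ w
  next^-reach u w = toℕ w + (n ∸ toℕ u) , (begin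
    (next ^ (toℕ w + (n ∸ toℕ u))) u          ≡⟨ ^-+ next (toℕ w) (n ∸ toℕ u) u ⟩
    (next ^ toℕ w) ((next ^ (n ∸ toℕ u)) u)   ≡⟨ cong (next ^ toℕ w) (next^-reach-zero u) ⟩
    (next ^ toℕ w) zero                       ≡⟨ next^-toℕ w ⟩
    w                                         ∎)
    where open ≡-Reasoning

  next^-aperiodic : ∀ {j} u → 0 < j → j < n → (next ^ j) u ≢ u
  next^-aperiodic {j} u 0<j j<n next^ju≡u = <⇒≢ 0<j (begin
    0                         ≡⟨ cong toℕ (sym next^j0≡0) ⟩
    toℕ ((next ^ j) zero)     ≡⟨ toℕ-next^-zero j j<n ⟩
    j                         ∎)
    where
    open ≡-Reasoning
    next^j0≡0 : (next ^ j) zero ≡ zero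
    next^j0≡0 = ^-injective next next-injective (toℕ u) (begin
      (next ^ toℕ u) ((next ^ j) zero)   ≡⟨ ^-comm next (toℕ u) j zero ⟩
      (next ^ j) ((next ^ toℕ u) zero)   ≡⟨ cong (next ^ j) (next^-toℕ u) ⟩
      (next ^ j) u                       ≡⟨ next^ju≡u ⟩
      u                                  ≡⟨ sym (next^-toℕ u) ⟩
      (next ^ toℕ u) zero                ∎)

module Wheel (m : ℕ) where

  open Cycle m public

  -- The rim vertex v_i is u = i − 1 : Fin n, with vertex number suc (toℕ u) in Joins (the centre is 0);
  -- rimEdge u is the rim edge v_i v_{i+1}, with label 2i − 1, and spokeEdge u the spoke c v_i, with label 2i.
  rimEdge spokeEdge : Fin n → Fin (2 * n)
  rimEdge   u = cast (*-comm n 2) (combine u zero)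
  spokeEdge u = cast (*-comm n 2) (combine u (suc zero))

  toℕ-rimEdge : ∀ u → toℕ (rimEdge u) ≡ 2 * toℕ u
  toℕ-rimEdge u = begin
    toℕ (rimEdge u)            ≡⟨ toℕ-cast (*-comm n 2) (combine u zero) ⟩
    toℕ (combine u zero)       ≡⟨ toℕ-combine u zero ⟩
    2 * toℕ u + 0              ≡⟨ +-identityʳ (2 * toℕ u) ⟩
    2 * toℕ u                  ∎
    where open ≡-Reasoning

  toℕ-spokeEdge : ∀ u → toℕ (spokeEdge u) ≡ suc (2 * toℕ u)
  toℕ-spokeEdge u = begin
    toℕ (spokeEdge u)          ≡⟨ toℕ-cast (*-comm n 2) (combine u (suc zero)) ⟩
    toℕ (combine u (suc zero)) ≡⟨ toℕ-combine u (suc zero) ⟩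
    2 * toℕ u + 1              ≡⟨ +-comm (2 * toℕ u) 1 ⟩
    suc (2 * toℕ u)            ∎
    where open ≡-Reasoning

  rimEdge-injective : Injective _≡_ _≡_ rimEdge
  rimEdge-injective {u} {w} eq = toℕ-injective (*-cancelˡ-≡ (toℕ u) (toℕ w) 2
    (trans (sym (toℕ-rimEdge u)) (trans (cong toℕ eq) (toℕ-rimEdge w))))

  spokeEdge-injective : Injective _≡_ _≡_ spokeEdge
  spokeEdge-injective {u} {w} eq = toℕ-injective (*-cancelˡ-≡ (toℕ u) (toℕ w) 2
    (suc-injective (trans (sym (toℕ-spokeEdge u)) (trans (cong toℕ eq) (toℕ-spokeEdge w)))))

  rimEdge≢spokeEdge : ∀ u w → rimEdge u ≢ spokeEdge w
  rimEdge≢spokeEdge u w eq =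
    even≢odd (toℕ u) (toℕ w) (trans (sym (toℕ-rimEdge u)) (trans (cong toℕ eq) (toℕ-spokeEdge w)))

  data EdgeView (e : Fin (2 * n)) : Set where
    isRim   : ∀ u → e ≡ rimEdge u → EdgeView e
    isSpoke : ∀ u → e ≡ spokeEdge u → EdgeView e

  edgeView : ∀ e → EdgeView e
  edgeView e with combine-surjective {n} {2} (cast (*-comm 2 n) e)
  ... | u , b , combine≡e = view b e≡
    where
    e≡ : e ≡ cast (*-comm n 2) (combine u b)
    e≡ = toℕ-injective (begin
      toℕ e                                  ≡⟨ sym (toℕ-cast (*-comm 2 n) e) ⟩
      toℕ (cast (*-comm 2 n) e)              ≡⟨ cong toℕ (sym combine≡e) ⟩
      toℕ (combine u b)                      ≡⟨ sym (toℕ-cast (*-comm n 2) (combine u b)) ⟩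
      toℕ (cast (*-comm n 2) (combine u b))  ∎)
      where open ≡-Reasoning
    view : ∀ b → e ≡ cast (*-comm n 2) (combine u b) → EdgeView e
    view zero       = isRim u
    view (suc zero) = isSpoke u

  byKind : {A : Set} → (Fin n → A) → (Fin n → A) → Fin (2 * n) → A
  byKind onRim onSpoke e with edgeView e
  ... | isRim   u _ = onRim u
  ... | isSpoke u _ = onSpoke u

  byKind-rimEdge : ∀ {A : Set} (onRim onSpoke : Fin n → A) u →
                   byKind onRim onSpoke (rimEdge u) ≡ onRim u
  byKind-rimEdge onRim onSpoke u with edgeView (rimEdge u)
  ... | isRim   u′ eq = cong onRim (rimEdge-injective (sym eq))
  ... | isSpoke u′ eq = ⊥-elim (rimEdge≢spokeEdge u u′ eq)

  byKind-spokeEdge : ∀ {A : Set} (onRim onSpoke : Fin n → A) u →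
                     byKind onRim onSpoke (spokeEdge u) ≡ onSpoke u
  byKind-spokeEdge onRim onSpoke u with edgeView (spokeEdge u)
  ... | isRim   u′ eq = ⊥-elim (rimEdge≢spokeEdge u′ u (sym eq))
  ... | isSpoke u′ eq = cong onSpoke (spokeEdge-injective (sym eq))

  2*[1+i]∸1≡1+2*i : ∀ i → 2 * suc i ∸ 1 ≡ suc (2 * i)
  2*[1+i]∸1≡1+2*i i = cong (_∸ 1) (*-suc 2 i)

  label-rimEdge : ∀ u → label (rimEdge u) ≡ suc (2 * toℕ u)
  label-rimEdge u = cong suc (toℕ-rimEdge u)

  label-spokeEdge : ∀ u → label (spokeEdge u) ≡ suc (suc (2 * toℕ u))
  label-spokeEdge u = cong suc (toℕ-spokeEdge u)

  nextV-next : ∀ u → nextV n (suc (toℕ u)) ≡ suc (toℕ (next u))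
  nextV-next u with toℕ u ≡ᵇ m in u≡ᵇm
  ... | true  = cong (suc ∘ toℕ) (sym (next-last u (≡ᵇ⇒≡ (toℕ u) m (subst T (sym u≡ᵇm) tt))))
  ... | false = cong suc (sym (toℕ-next u (toℕ<m u λ u≡m → subst T u≡ᵇm (≡⇒≡ᵇ (toℕ u) m u≡m))))

  joins-rimEdge : ∀ u → Joins n (label (rimEdge u)) (suc (toℕ u)) (suc (toℕ (next u)))
  joins-rimEdge u =
    inj₁ (suc (toℕ u) , s≤s z≤n , toℕ<n u , trans (label-rimEdge u) (sym (2*[1+i]∸1≡1+2*i (toℕ u))) ,
          refl , sym (nextV-next u))

  joins-spokeEdge : ∀ u → Joins n (label (spokeEdge u)) 0 (suc (toℕ u))
  joins-spokeEdge u =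
    inj₂ (suc (toℕ u) , s≤s z≤n , toℕ<n u , trans (label-spokeEdge u) (sym (*-suc 2 (toℕ u))) ,
          refl , refl)

  joins-rimEdge⁻ : ∀ {u x y} → Joins n (label (rimEdge u)) x y →
                   x ≡ suc (toℕ u) × y ≡ suc (toℕ (next u))
  joins-rimEdge⁻ {u} (inj₁ (suc i , _ , _ , ℓ≡ , refl , refl))
    with *-cancelˡ-≡ (toℕ u) i 2
           (suc-injective (trans (sym (label-rimEdge u)) (trans ℓ≡ (2*[1+i]∸1≡1+2*i i))))
  ... | refl = refl , nextV-next u
  joins-rimEdge⁻ {u} (inj₂ (suc i , _ , _ , ℓ≡ , _ , _)) =
    ⊥-elim (even≢odd (suc i) (toℕ u) (trans (sym ℓ≡) (label-rimEdge u)))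

  joins-spokeEdge⁻ : ∀ {u x y} → Joins n (label (spokeEdge u)) x y → x ≡ 0 × y ≡ suc (toℕ u)
  joins-spokeEdge⁻ {u} (inj₂ (suc i , _ , _ , ℓ≡ , refl , refl))
    with *-cancelˡ-≡ (toℕ u) i 2
           (suc-injective (suc-injective (trans (sym (label-spokeEdge u)) (trans ℓ≡ (*-suc 2 i)))))
  ... | refl = refl , refl
  joins-spokeEdge⁻ {u} (inj₁ (suc i , _ , _ , ℓ≡ , _ , _)) =
    ⊥-elim (even≢odd i (toℕ u)
      (sym (suc-injective (trans (sym (label-spokeEdge u)) (trans ℓ≡ (2*[1+i]∸1≡1+2*i i))))))

  joins-unique : ∀ {e x y x′ y′} → Joins n (label e) x y → Joins n (label e) x′ y′ →
                 x ≡ x′ × y ≡ y′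
  joins-unique {e} j j′ with edgeView e
  ... | isRim u refl =
    let x≡ , y≡ = joins-rimEdge⁻ {u} j ; x′≡ , y′≡ = joins-rimEdge⁻ {u} j′
    in trans x≡ (sym x′≡) , trans y≡ (sym y′≡)
  ... | isSpoke u refl =
    let x≡ , y≡ = joins-spokeEdge⁻ {u} j ; x′≡ , y′≡ = joins-spokeEdge⁻ {u} j′
    in trans x≡ (sym x′≡) , trans y≡ (sym y′≡)

  Links : Fin (2 * n) → ℕ → ℕ → Set
  Links e x y = Joins n (label e) x y ⊎ Joins n (label e) y x

  links-ends : ∀ {e a b x y} → Links e a b → Links e x y → (x ≡ a × y ≡ b) ⊎ (x ≡ b × y ≡ a)
  links-ends (inj₁ jab) (inj₁ jxy) = inj₁ (joins-unique jxy jab)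
  links-ends (inj₁ jab) (inj₂ jyx) = inj₂ (swap (joins-unique jyx jab))
  links-ends (inj₂ jba) (inj₁ jxy) = inj₂ (joins-unique jxy jba)
  links-ends (inj₂ jba) (inj₂ jyx) = inj₁ (swap (joins-unique jyx jba))

  interval star : Fin n → Direction → Fin (2 * n)
  interval u left  = rimEdge u
  interval u spoke = spokeEdge u
  interval u right = rimEdge (next u)
  star u left  = rimEdge (prev u)
  star u spoke = spokeEdge u
  star u right = rimEdge u

  -- Shifting every rim label down by two turns each necklace interval into the star of a rim vertex.
  rotate : Fin (2 * n) ↔ Fin (2 * n)
  rotate = mk↔ₛ′ (shift prev) (shift next)
    (λ e → shift-inverse {next} {prev} prev-next (edgeView e))
    (λ e → shift-inverse {prev} {next} next-prev (edgeView e))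
    where
    shift : (Fin n → Fin n) → Fin (2 * n) → Fin (2 * n)
    shift f = byKind (rimEdge ∘ f) spokeEdge

    shift-inverse : ∀ {f g} → (∀ u → g (f u) ≡ u) → ∀ {e} → EdgeView e → shift g (shift f e) ≡ e
    shift-inverse {f} {g} g∘f≡id (isRim u refl) = begin
      shift g (shift f (rimEdge u))   ≡⟨ cong (shift g) (byKind-rimEdge (rimEdge ∘ f) spokeEdge u) ⟩
      shift g (rimEdge (f u))         ≡⟨ byKind-rimEdge (rimEdge ∘ g) spokeEdge (f u) ⟩
      rimEdge (g (f u))               ≡⟨ cong rimEdge (g∘f≡id u) ⟩
      rimEdge u                       ∎
      where open ≡-Reasoning
    shift-inverse {f} {g} _ (isSpoke u refl) = begin
      shift g (shift f (spokeEdge u))   ≡⟨ cong (shift g) (byKind-spokeEdge (rimEdge ∘ f) spokeEdge u) ⟩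
      shift g (spokeEdge u)             ≡⟨ byKind-spokeEdge (rimEdge ∘ g) spokeEdge u ⟩
      spokeEdge u                       ∎
      where open ≡-Reasoning

  rotate-interval : ∀ u d → Inverse.to rotate (interval u d) ≡ star u d
  rotate-interval u left  = byKind-rimEdge (rimEdge ∘ prev) spokeEdge u
  rotate-interval u spoke = byKind-spokeEdge (rimEdge ∘ prev) spokeEdge u
  rotate-interval u right = trans (byKind-rimEdge (rimEdge ∘ prev) spokeEdge (next u)) (cong rimEdge (prev-next u))

  label-rimEdge-next : ∀ u → toℕ u ≢ m → label (rimEdge (next u)) ≡ 2 * suc (toℕ u) + 1
  label-rimEdge-next u u≢m = begin
    label (rimEdge (next u))    ≡⟨ label-rimEdge (next u) ⟩
    suc (2 * toℕ (next u))      ≡⟨ cong (λ k → suc (2 * k)) (toℕ-next u (toℕ<m u u≢m)) ⟩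
    suc (2 * suc (toℕ u))       ≡⟨ +-comm 1 _ ⟩
    2 * suc (toℕ u) + 1         ∎
    where open ≡-Reasoning

  label-rimEdge-next-last : ∀ u → toℕ u ≡ m → label (rimEdge (next u)) ≡ 1
  label-rimEdge-next-last u u≡m = trans (cong (label ∘ rimEdge) (next-last u u≡m)) (label-rimEdge zero)

  inInterval⇔ : ∀ u x → InInterval n (suc (toℕ u)) (label x) ⇔ ∃ λ d → interval u d ≡ x
  inInterval⇔ u x = mk⇔ forth back
    where
    forth : InInterval n (suc (toℕ u)) (label x) → ∃ λ d → interval u d ≡ x
    forth (inj₁ x≡) =
      left , label-injective (trans (label-rimEdge u) (trans (sym (2*[1+i]∸1≡1+2*i (toℕ u))) (sym x≡)))
    forth (inj₂ (inj₁ x≡)) =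
      spoke , label-injective (trans (label-spokeEdge u) (trans (sym (*-suc 2 (toℕ u))) (sym x≡)))
    forth (inj₂ (inj₂ (inj₁ (u≢n , x≡)))) =
      right , label-injective (trans (label-rimEdge-next u (u≢n ∘ cong suc)) (sym x≡))
    forth (inj₂ (inj₂ (inj₂ (u≡n , x≡)))) =
      right , label-injective (trans (label-rimEdge-next-last u (suc-injective u≡n)) (sym x≡))

    back : ∃ (λ d → interval u d ≡ x) → InInterval n (suc (toℕ u)) (label x)
    back (left  , refl) = inj₁ (trans (label-rimEdge u) (sym (2*[1+i]∸1≡1+2*i (toℕ u))))
    back (spoke , refl) = inj₂ (inj₁ (trans (label-spokeEdge u) (sym (*-suc 2 (toℕ u)))))
    back (right , refl) with toℕ u ≟ m
    ... | yes u≡m = inj₂ (inj₂ (inj₂ (cong suc u≡m , label-rimEdge-next-last u u≡m)))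
    ... | no  u≢m = inj₂ (inj₂ (inj₁ (u≢m ∘ suc-injective , label-rimEdge-next u u≢m)))

  necklaceBasis⇔transversal : ∀ B → NecklaceBasis n B ⇔ Transversal interval B
  necklaceBasis⇔transversal B = mk⇔ forth back
    where
    forth : NecklaceBasis n B → Transversal interval B
    forth (f , f-inj , f-int , f-B) = mkTransversal d
      (λ i → subst (_∈ B) (sym (d-spec i)) (Equivalence.from (f-B (f i)) (i , refl)))
      (λ eq → f-inj (trans (sym (d-spec _)) (trans eq (d-spec _))))
      (λ y y∈B → let i , fi≡y = Equivalence.to (f-B y) y∈B in i , trans (d-spec i) fi≡y)
      where
      d : Fin n → Direction
      d i = proj₁ (Equivalence.to (inInterval⇔ i (f i)) (f-int i))
      d-spec : ∀ i → interval i (d i) ≡ f i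
      d-spec i = proj₂ (Equivalence.to (inInterval⇔ i (f i)) (f-int i))

    back : Transversal interval B → NecklaceBasis n B
    back (mkTransversal d d-∈ d-inj d-onto) =
      (λ i → interval i (d i)) , d-inj , (λ i → Equivalence.from (inInterval⇔ i _) (d i , refl)) ,
      (λ x → mk⇔ (d-onto x) λ { (i , refl) → d-∈ i })

  lookup-rim : ∀ e → lookup (rim n) e ≡ (if toℕ e % 2 ≡ᵇ 0 then inside else outside)
  lookup-rim = lookup∘tabulate (λ e → if toℕ e % 2 ≡ᵇ 0 then inside else outside)

  lookup-rim-rimEdge : ∀ u → lookup (rim n) (rimEdge u) ≡ inside
  lookup-rim-rimEdge u = trans (lookup-rim (rimEdge u)) (cong (λ k → if k ≡ᵇ 0 then inside else outside) (begin
    toℕ (rimEdge u) % 2   ≡⟨ cong (_% 2) (trans (toℕ-rimEdge u) (*-comm 2 (toℕ u))) ⟩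
    toℕ u * 2 % 2         ≡⟨ m*n%n≡0 (toℕ u) 2 ⟩
    0                     ∎))
    where open ≡-Reasoning

  lookup-rim-spokeEdge : ∀ u → lookup (rim n) (spokeEdge u) ≡ outside
  lookup-rim-spokeEdge u =
    trans (lookup-rim (spokeEdge u)) (cong (λ k → if k ≡ᵇ 0 then inside else outside) (begin
    toℕ (spokeEdge u) % 2   ≡⟨ cong (_% 2) (trans (toℕ-spokeEdge u) (cong suc (*-comm 2 (toℕ u)))) ⟩
    (1 + toℕ u * 2) % 2     ≡⟨ [m+kn]%n≡m%n 1 (toℕ u) 2 ⟩
    1                       ∎))
    where open ≡-Reasoning

  rimEdge-∈-rim : ∀ u → rimEdge u ∈ rim n
  rimEdge-∈-rim u = lookup⇒[]= (rimEdge u) (rim n) (lookup-rim-rimEdge u)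

  spokeEdge-∉-rim : ∀ u → spokeEdge u ∉ rim n
  spokeEdge-∉-rim u s∈rim with () ← trans (sym (lookup-rim-spokeEdge u)) ([]=⇒lookup s∈rim)

  ∈-rim⇒rimEdge : ∀ {y} → y ∈ rim n → ∃ λ u → rimEdge u ≡ y
  ∈-rim⇒rimEdge {y} y∈rim with edgeView y
  ... | isRim   u refl = u , refl
  ... | isSpoke u refl = ⊥-elim (spokeEdge-∉-rim u y∈rim)

  rim-transversal : Transversal star (rim n)
  rim-transversal = mkTransversal (λ _ → right) rimEdge-∈-rim rimEdge-injective (λ _ → ∈-rim⇒rimEdge)

  towards : Fin n → Direction → Fin (suc n)
  towards u left  = suc (prev u)
  towards u spoke = zero
  towards u right = suc (next u)

  star-links : ∀ u d → Links (star u d) (suc (toℕ u)) (toℕ (towards u d))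
  star-links u left  =
    inj₂ (subst (λ w → Joins n (label (rimEdge (prev u))) (suc (toℕ (prev u))) (suc (toℕ w)))
                (next-prev u) (joins-rimEdge (prev u)))
  star-links u spoke = inj₂ (joins-spokeEdge u)
  star-links u right = inj₁ (joins-rimEdge u)

  star-∈-rim : ∀ u {d} → d ≢ spoke → star u d ∈ rim n
  star-∈-rim u {left}  _  = rimEdge-∈-rim (prev u)
  star-∈-rim u {spoke} d≢ = contradiction refl d≢
  star-∈-rim u {right} _  = rimEdge-∈-rim u

  vertex-injective : ∀ {u w : Fin n} → suc (toℕ u) ≡ suc (toℕ w) → u ≡ w
  vertex-injective = toℕ-injective ∘ suc-injective

  rim-walk : ∀ {S} j u → (∀ {i} → i < j → rimEdge ((next ^ i) u) ∈ S) →
             Reach n S (suc (toℕ u)) (suc (toℕ ((next ^ j) u)))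
  rim-walk zero    u _   = here
  rim-walk (suc j) u run =
    Reach-trans (rim-walk j u (run ∘ m<n⇒m<1+n))
                (step (rimEdge ((next ^ j) u)) (run ≤-refl) (inj₁ (joins-rimEdge _)) here)

  -- Vertices as Fin (suc n): zero is the centre and suc u the rim vertex numbered suc (toℕ u).
  module ParentTree {T : Subset (2 * n)}
    (par : Fin (suc n) → Fin (suc n)) (root-fixed : par zero ≡ zero)
    (reaches-root : ∀ w → ∃ λ k → (par ^ k) w ≡ zero)
    (edge : Fin n → Fin (2 * n))
    (edge-links : ∀ u → Links (edge u) (suc (toℕ u)) (toℕ (par (suc u))))
    (edge-∈ : ∀ u → edge u ∈ T) (edge-onto : ∀ e → e ∈ T → ∃ λ u → edge u ≡ e) where

    reach-root : ∀ k w → (par ^ k) w ≡ zero → Reach n T (toℕ w) 0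
    reach-root k       zero    _  = here
    reach-root (suc k) (suc u) eq =
      step (edge u) (edge-∈ u) (edge-links u) (reach-root k (par (suc u)) (trans (^-shift par k (suc u)) eq))

    connected : ∀ x y → x ≤ n → y ≤ n → Reach n T x y
    connected x y x≤n y≤n = Reach-trans (to-root x≤n) (Reach-sym (to-root y≤n))
      where
      to-root : ∀ {x} → x ≤ n → Reach n T x 0
      to-root {x} x≤n =
        let w = fromℕ< (s≤s x≤n) ; k , parᵏw≡0 = reaches-root w
        in subst (λ x → Reach n T x 0) (toℕ-fromℕ< (s≤s x≤n)) (reach-root k w parᵏw≡0)

    module Descendants (k : Fin n) where

      Desc : Fin (suc n) → Set
      Desc w = ∃ λ j → (par ^ j) w ≡ suc k

      DescAt : ℕ → Set
      DescAt x = ∃ λ w → toℕ w ≡ x × Desc w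

      desc-par : ∀ {u} → u ≢ k → Desc (suc u) → Desc (par (suc u))
      desc-par u≢k (zero  , eq) = ⊥-elim (u≢k (Fin.suc-injective eq))
      desc-par u≢k (suc j , eq) = j , trans (^-shift par j _) eq

      desc-child : ∀ {u} → Desc (par (suc u)) → Desc (suc u)
      desc-child (j , eq) = suc j , trans (sym (^-shift par j _)) eq

      -- Removing the edge of k cuts the descendants of v_k off from the rest of the tree.
      desc-step : ∀ {e x y} → e ∈ T - edge k → Links e x y → DescAt x → DescAt y
      desc-step {e} e∈T-k j (w , refl , desc) with edge-onto e (p─q⊆p T _ e∈T-k)
      ... | u , refl with links-ends {edge u} (edge-links u) j
      ...   | inj₁ (w≡ , refl) = par (suc u) , refl , desc-par u≢k (subst Desc (toℕ-injective w≡) desc)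
        where u≢k : u ≢ k
              u≢k refl = y∉p-y T _ e∈T-k
      ...   | inj₂ (w≡ , refl) = suc u , refl , desc-child (subst Desc (toℕ-injective w≡) desc)

      Reach-desc : ∀ {x y} → Reach n (T - edge k) x y → DescAt x → DescAt y
      Reach-desc here d = d
      Reach-desc (step e e∈ j r) d = Reach-desc r (desc-step e∈ j d)

      -- v_k would lie on a cycle of par, yet its par-orbit ends in the fixed point c.
      par-not-desc : ¬ Desc (par (suc k))
      par-not-desc (i , parⁱ[par-k]≡k) with reaches-root (suc k)
      ... | M , parᴹk≡0 = Fin.0≢1+n (begin
        zero                                  ≡⟨ sym (^-fixed par root-fixed (M * i)) ⟩
        (par ^ (M * i)) zero                  ≡⟨ cong (par ^ (M * i)) (sym parᴹk≡0) ⟩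
        (par ^ (M * i)) ((par ^ M) (suc k))   ≡⟨ sym (^-+ par (M * i) M (suc k)) ⟩
        (par ^ (M * i + M)) (suc k)           ≡⟨ cong (λ j → (par ^ j) (suc k))
                                                      (trans (+-comm (M * i) M) (sym (*-suc M i))) ⟩
        (par ^ (M * suc i)) (suc k)           ≡⟨ ^-periodic par (suc i) k-periodic M ⟩
        suc k                                 ∎)
        where
        open ≡-Reasoning
        k-periodic : (par ^ suc i) (suc k) ≡ suc k
        k-periodic = trans (sym (^-shift par i (suc k))) parⁱ[par-k]≡k

      no-detour : ¬ Reach n (T - edge k) (suc (toℕ k)) (toℕ (par (suc k)))
      no-detour r with Reach-desc r (suc k , refl , 0 , refl)
      ... | w , w≡ , desc = par-not-desc (subst Desc (toℕ-injective w≡) desc)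

    acyclic : ∀ e → e ∈ T → ∀ a b → Joins n (label e) a b → ¬ Reach n (T - e) a b
    acyclic e e∈T a b jab r with edge-onto e e∈T
    ... | k , refl with links-ends (edge-links k) (inj₁ jab)
    ...   | inj₁ (refl , refl) = Descendants.no-detour k r
    ...   | inj₂ (refl , refl) = Descendants.no-detour k (Reach-sym r)

    spanningTree : SpanningTree n T
    spanningTree = connected , acyclic

  module FromTransversal (1≤m : 1 ≤ m) {T : Subset (2 * n)} (tr : Transversal star T) where

    open Transversal tr renaming (choice to d)

    no-right-left : ∀ u → d u ≡ right → d (next u) ≢ left
    no-right-left u du dnu = next^-aperiodic u (s≤s z≤n) (s≤s 1≤m) (chosen-injective (begin
      star (next u) (d (next u))  ≡⟨ cong (star (next u)) dnu ⟩
      rimEdge (prev (next u))     ≡⟨ cong rimEdge (prev-next u) ⟩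
      rimEdge u                   ≡⟨ cong (star u) (sym du) ⟩
      star u (d u)                ∎))
      where open ≡-Reasoning

    parent : Fin (suc n) → Fin (suc n)
    parent zero    = zero
    parent (suc u) = towards u (d u)

    Rooted : Fin (suc n) → Set
    Rooted w = ∃ λ k → (parent ^ k) w ≡ zero

    rooted-parent : ∀ {w} → Rooted (parent w) → Rooted w
    rooted-parent {w} (k , eq) = suc k , trans (sym (^-shift parent k w)) eq

    rooted-towards : ∀ {u dir} → d u ≡ dir → Rooted (towards u dir) → Rooted (suc u)
    rooted-towards du r = rooted-parent (subst Rooted (cong (towards _) (sym du)) r)

    module _ (s : Fin n) (ds : d s ≡ spoke) where

      rooted-right : ∀ j u → d u ≢ left → (next ^ j) u ≡ s → Rooted (suc u)
      rooted-right zero    u _        refl = rooted-towards ds (0 , refl)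
      rooted-right (suc j) u not-left eq with d u in du
      ... | spoke = rooted-towards du (0 , refl)
      ... | left  = contradiction refl not-left
      ... | right = rooted-towards du (rooted-right j (next u) (no-right-left u du) (trans (^-shift next j u) eq))

      rooted-left : ∀ j u → d u ≢ right → (next ^ j) s ≡ u → Rooted (suc u)
      rooted-left zero    u _         refl = rooted-towards ds (0 , refl)
      rooted-left (suc j) u not-right refl with d u in du
      ... | spoke = rooted-towards du (0 , refl)
      ... | right = contradiction refl not-right
      ... | left  = rooted-towards du (subst (Rooted ∘ suc) (sym (prev-next w))
                      (rooted-left j w (λ dw → no-right-left w dw du) refl))
        where
        w : Fin n
        w = (next ^ j) s

      rooted : ∀ w → Rooted w
      rooted zero = 0 , refl
      rooted (suc u) with d u in du
      ... | spoke = rooted-towards du (0 , refl)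
      ... | right = let j , eq = next^-reach u s in rooted-right j u (λ dl → case trans (sym du) dl of λ ()) eq
      ... | left  = let j , eq = next^-reach s u in rooted-left j u (λ dr → case trans (sym du) dr of λ ()) eq

      spanningTree : SpanningTree n T
      spanningTree = ParentTree.spanningTree parent refl rooted
        (λ u → star u (d u)) (λ u → star-links u (d u)) chosen-∈ chosen-onto

    only-right : ∀ {dir} → dir ≢ spoke → dir ≢ left → dir ≡ right
    only-right {left}  _ ≢left  = contradiction refl ≢left
    only-right {spoke} ≢spoke _ = contradiction refl ≢spoke
    only-right {right} _ _      = refl

    only-left : ∀ {dir} → dir ≢ spoke → dir ≢ right → dir ≡ left
    only-left {left}  _ _        = refl
    only-left {spoke} ≢spoke _   = contradiction refl ≢spoke
    only-left {right} _ ≢right   = contradiction refl ≢right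

    -- Without spokes, the choices all point the same way around the rim.
    rimEdge-∈ : (∀ u → d u ≢ spoke) → ∀ u → rimEdge u ∈ T
    rimEdge-∈ no-spoke u with any? (λ w → d w ≟ᵈ right)
    ... | yes (w , dw) =
      let j , wʲ≡u = next^-reach w u
      in subst (_∈ T) (cong (star u) (subst (λ x → d x ≡ right) wʲ≡u (all-right j))) (chosen-∈ u)
      where
      all-right : ∀ j → d ((next ^ j) w) ≡ right
      all-right zero    = dw
      all-right (suc j) = only-right (no-spoke _) (no-right-left _ (all-right j))
    ... | no no-right =
      subst (_∈ T) (trans (cong (star (next u)) (only-left (no-spoke (next u)) (no-right ∘ (next u ,_))))
                          (cong rimEdge (prev-next u)))
                   (chosen-∈ (next u))

    transversal⇒whirlBasis : WhirlBasis n T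
    transversal⇒whirlBasis with any? (λ s → d s ≟ᵈ spoke)
    ... | yes (s , ds) = inj₁ (spanningTree s ds)
    ... | no  ∄spoke   = inj₂ (⊆-antisym T⊆rim rim⊆T)
      where
      no-spoke : ∀ u → d u ≢ spoke
      no-spoke u du = ∄spoke (u , du)
      T⊆rim : T ⊆ rim n
      T⊆rim y∈T = let i , eq = chosen-onto _ y∈T in subst (_∈ rim n) eq (star-∈-rim i (no-spoke i))
      rim⊆T : rim n ⊆ T
      rim⊆T y∈rim = let u , eq = ∈-rim⇒rimEdge y∈rim in subst (_∈ T) eq (rimEdge-∈ no-spoke u)

  module FromSpanningTree {T : Subset (2 * n)} (tree : SpanningTree n T) where

    RimRun : ℕ → Fin n → Set
    RimRun j u = ∀ {i} → i < j → rimEdge ((next ^ i) u) ∈ T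

    RimRun-snoc : ∀ {j u} → RimRun j u → rimEdge ((next ^ j) u) ∈ T → RimRun (suc j) u
    RimRun-snoc run r∈ i<j+1 with m<1+n⇒m<n∨m≡n i<j+1
    ... | inj₁ i<j  = run i<j
    ... | inj₂ refl = r∈

    RimRun-cons : ∀ {j u} → rimEdge u ∈ T → RimRun j (next u) → RimRun (suc j) u
    RimRun-cons r∈ run {zero}  _         = r∈
    RimRun-cons {u = u} r∈ run {suc i} (s≤s i<j) = subst (λ x → rimEdge x ∈ T) (^-shift next i u) (run i<j)

    RimRun-uncons : ∀ {j u} → RimRun (suc j) u → RimRun j (next u)
    RimRun-uncons {u = u} run {i} i<j = subst (λ x → rimEdge x ∈ T) (sym (^-shift next i u)) (run (s≤s i<j))

    SpokeAhead : Fin n → Set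
    SpokeAhead u = ∃ λ j → j < n × RimRun j u × spokeEdge ((next ^ j) u) ∈ T

    spokeAhead? : ∀ u → Dec (SpokeAhead u)
    spokeAhead? u =
      anyUpTo? (λ j → allUpTo? (λ i → rimEdge ((next ^ i) u) ∈? T) j ×-dec spokeEdge ((next ^ j) u) ∈? T) n

    spokeAhead-here : ∀ {u} → spokeEdge u ∈ T → SpokeAhead u
    spokeAhead-here s∈ = 0 , s≤s z≤n , (λ ()) , s∈

    spokeAhead-next : ∀ {u} → spokeEdge u ∉ T → SpokeAhead u → rimEdge u ∈ T × SpokeAhead (next u)
    spokeAhead-next s∉ (zero , _ , _ , s∈) = contradiction s∈ s∉
    spokeAhead-next {u} s∉ (suc j , j+1<n , run , s∈) =
      run (s≤s z≤n) , j , <-trans (n<1+n j) j+1<n , RimRun-uncons run ,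
      subst (λ x → spokeEdge x ∈ T) (sym (^-shift next j u)) s∈

    spokeAhead-prev : ∀ {u} → rimEdge u ∈ T → SpokeAhead (next u) → SpokeAhead u
    spokeAhead-prev {u} r∈ (j , j<n , run , s∈) with m≤n⇒m<n∨m≡n j<n
    ... | inj₁ j+1<n =
      suc j , j+1<n , RimRun-cons r∈ run , subst (λ x → spokeEdge x ∈ T) (^-shift next j u) s∈
    ... | inj₂ refl  =
      spokeAhead-here (subst (λ x → spokeEdge x ∈ T) (trans (^-shift next j u) (next^n u)) s∈)

    -- A spoke, the rim edge beside it and the rim run ahead to another spoke would close a cycle.
    no-spokeAhead-beside-spoke : ∀ {u} → spokeEdge u ∈ T → rimEdge u ∈ T → ¬ SpokeAhead (next u)
    no-spokeAhead-beside-spoke {u} su∈ ru∈ (j , j<n , run , sw∈) =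
      proj₂ tree (rimEdge u) ru∈ _ _ (joins-rimEdge u) (
        step (spokeEdge u) (avoid su∈ (rimEdge≢spokeEdge u u ∘ sym)) (inj₂ (joins-spokeEdge u)) (
        step (spokeEdge w) (avoid sw∈ (rimEdge≢spokeEdge u w ∘ sym)) (inj₁ (joins-spokeEdge w)) (
        Reach-sym (rim-walk j (next u) λ {i} i<j → avoid (run i<j) (away i<j)))))
      where
      w : Fin n
      w = (next ^ j) (next u)
      avoid : ∀ {e} → e ∈ T → e ≢ rimEdge u → e ∈ T - rimEdge u
      avoid = x∈p∧x≢y⇒x∈p-y
      away : ∀ {i} → i < j → rimEdge ((next ^ i) (next u)) ≢ rimEdge u
      away {i} i<j eq = next^-aperiodic u (s≤s z≤n) (<-≤-trans (s≤s i<j) j<n)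
        (trans (sym (^-shift next i u)) (rimEdge-injective eq))

    Ahead : Fin n → ℕ → Set
    Ahead u x = ∃ λ j → j < n × RimRun j u × x ≡ suc (toℕ ((next ^ j) u))

    ahead-next : ∀ {u j} → j < n → RimRun j u → rimEdge ((next ^ j) u) ∈ T →
                 Ahead u (suc (toℕ (next ((next ^ j) u))))
    ahead-next {u} {j} j<n run r∈ with m≤n⇒m<n∨m≡n j<n
    ... | inj₁ j+1<n = suc j , j+1<n , RimRun-snoc run r∈ , refl
    ... | inj₂ refl  = 0 , s≤s z≤n , (λ ()) , cong (suc ∘ toℕ) (next^n u)

    ahead-prev : ∀ {u j z} → rimEdge (prev u) ∉ T → j < n → RimRun j u →
                 rimEdge z ∈ T → next z ≡ (next ^ j) u → Ahead u (suc (toℕ z))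
    ahead-prev {u} {zero} {z} no-left _ _ r∈ eq =
      contradiction (subst (λ x → rimEdge x ∈ T) (trans (sym (prev-next z)) (cong prev eq)) r∈) no-left
    ahead-prev {u} {suc j} _ j+1<n run _ eq =
      j , <-trans (n<1+n j) j+1<n , run ∘ m<n⇒m<1+n , cong (suc ∘ toℕ) (next-injective eq)

    ahead-step : ∀ {u e x y} → ¬ SpokeAhead u → rimEdge (prev u) ∉ T →
                 e ∈ T → Links e x y → Ahead u x → Ahead u y
    ahead-step {u} {e} no-spoke no-left e∈T lk (j , j<n , run , refl) with edgeView e
    ... | isSpoke z refl with links-ends (inj₁ (joins-spokeEdge z)) lk
    ...   | inj₂ (x≡ , _) with vertex-injective x≡
    ...     | refl = ⊥-elim (no-spoke (j , j<n , run , e∈T))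
    ahead-step {u} {e} no-spoke no-left e∈T lk (j , j<n , run , refl) | isRim z refl
      with links-ends (inj₁ (joins-rimEdge z)) lk
    ...   | inj₁ (x≡ , refl) with vertex-injective x≡
    ...     | refl = ahead-next j<n run e∈T
    ahead-step {u} {e} no-spoke no-left e∈T lk (j , j<n , run , refl) | isRim z refl
          | inj₂ (x≡ , refl) = ahead-prev no-left j<n run e∈T (sym (vertex-injective x≡))

    -- Otherwise the T-component of v_u would consist of rim vertices ahead of u only, missing the centre.
    rimEdge-prev-∈ : ∀ {u} → ¬ SpokeAhead u → rimEdge (prev u) ∈ T
    rimEdge-prev-∈ {u} no-spoke with rimEdge (prev u) ∈? T
    ... | yes r∈  = r∈
    ... | no  r∉
      with Reach-ahead (proj₁ tree (suc (toℕ u)) 0 (toℕ<n u) z≤n) (0 , s≤s z≤n , (λ ()) , refl)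
      where
      Reach-ahead : ∀ {x y} → Reach n T x y → Ahead u x → Ahead u y
      Reach-ahead here               a = a
      Reach-ahead (step e e∈T lk r) a = Reach-ahead r (ahead-step no-spoke r∉ e∈T lk a)
    ...   | _ , _ , _ , ()

    -- The edge from v_u to its parent in T rooted at the centre: the spoke if it is in T, else the rim
    -- edge forward if a spoke in T is reachable forward along the rim inside T, else the rim edge behind.
    data Classified (u : Fin n) : Direction → Set where
      viaSpoke : spokeEdge u ∈ T → Classified u spoke
      viaRight : spokeEdge u ∉ T → SpokeAhead u → Classified u right
      viaLeft  : ¬ SpokeAhead u → Classified u left

    classify : ∀ u → ∃ (Classified u)
    classify u with spokeEdge u ∈? T | spokeAhead? u
    ... | yes s∈ | _        = spoke , viaSpoke s∈
    ... | no  s∉ | yes a    = right , viaRight s∉ a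
    ... | no  _  | no  ¬a   = left  , viaLeft ¬a

    classified-unique : ∀ {u d d′} → Classified u d → Classified u d′ → d ≡ d′
    classified-unique (viaSpoke _)   (viaSpoke _)    = refl
    classified-unique (viaSpoke s∈)  (viaRight s∉ _) = contradiction s∈ s∉
    classified-unique (viaSpoke s∈)  (viaLeft ¬a)    = contradiction (spokeAhead-here s∈) ¬a
    classified-unique (viaRight s∉ _) (viaSpoke s∈)  = contradiction s∈ s∉
    classified-unique (viaRight _ _) (viaRight _ _)  = refl
    classified-unique (viaRight _ a) (viaLeft ¬a)    = contradiction a ¬a
    classified-unique (viaLeft ¬a)   (viaSpoke s∈)   = contradiction (spokeAhead-here s∈) ¬a
    classified-unique (viaLeft ¬a)   (viaRight _ a)  = contradiction a ¬a
    classified-unique (viaLeft _)    (viaLeft _)     = refl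

    classified-∈ : ∀ {u d} → Classified u d → star u d ∈ T
    classified-∈ (viaSpoke s∈)   = s∈
    classified-∈ (viaRight s∉ a) = proj₁ (spokeAhead-next s∉ a)
    classified-∈ (viaLeft ¬a)    = rimEdge-prev-∈ ¬a

    classified-injective : ∀ {i j d d′} → Classified i d → Classified j d′ →
                           star i d ≡ star j d′ → i ≡ j
    classified-injective (viaSpoke _)    (viaSpoke _)    eq = spokeEdge-injective eq
    classified-injective {i} {j} (viaSpoke _)   (viaRight _ _) eq = ⊥-elim (rimEdge≢spokeEdge j i (sym eq))
    classified-injective {i} {j} (viaSpoke _)   (viaLeft _)    eq = ⊥-elim (rimEdge≢spokeEdge (prev j) i (sym eq))
    classified-injective {i} {j} (viaRight _ _) (viaSpoke _)   eq = ⊥-elim (rimEdge≢spokeEdge i j eq)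
    classified-injective {i} {j} (viaLeft _)    (viaSpoke _)   eq = ⊥-elim (rimEdge≢spokeEdge (prev i) j eq)
    classified-injective (viaRight _ _)  (viaRight _ _)  eq = rimEdge-injective eq
    classified-injective (viaLeft _)     (viaLeft _)     eq = prev-injective (rimEdge-injective eq)
    classified-injective (viaRight s∉ a) (viaLeft ¬a)    eq =
      contradiction (subst SpokeAhead (next-of-prev (rimEdge-injective eq))
                           (proj₂ (spokeAhead-next s∉ a))) ¬a
    classified-injective (viaLeft ¬a)    (viaRight s∉ a) eq =
      contradiction (subst SpokeAhead (next-of-prev (rimEdge-injective (sym eq)))
                           (proj₂ (spokeAhead-next s∉ a))) ¬a

    classified-onto : ∀ {y} → y ∈ T → ∃ λ i → ∃ λ d → Classified i d × star i d ≡ y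
    classified-onto {y} y∈T with edgeView y
    ... | isSpoke u refl = u , spoke , viaSpoke y∈T , refl
    ... | isRim u refl with classify u
    ...   | right , c = u , right , c , refl
    ...   | spoke , viaSpoke s∈ =
      next u , left , viaLeft (no-spokeAhead-beside-spoke s∈ y∈T) , cong rimEdge (prev-next u)
    ...   | left  , viaLeft ¬a  =
      next u , left , viaLeft (¬a ∘ spokeAhead-prev y∈T) , cong rimEdge (prev-next u)

    spanningTree⇒transversal : Transversal star T
    spanningTree⇒transversal = mkTransversal (λ u → proj₁ (classify u))
      (λ u → classified-∈ (proj₂ (classify u)))
      (λ eq → classified-injective (proj₂ (classify _)) (proj₂ (classify _)) eq)
      (λ y y∈T → let i , d , c , eq = classified-onto y∈T
                 in i , trans (cong (star i) (classified-unique (proj₂ (classify i)) c)) eq)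

  transversal⇔whirlBasis : 1 ≤ m → ∀ T → Transversal star T ⇔ WhirlBasis n T
  transversal⇔whirlBasis 1≤m T = mk⇔ (FromTransversal.transversal⇒whirlBasis 1≤m) λ where
    (inj₁ tree) → FromSpanningTree.spanningTree⇒transversal tree
    (inj₂ refl) → rim-transversal

  necklace≅whirl : 1 ≤ m → NecklaceIsoWhirl n
  necklace≅whirl 1≤m = rotate , λ B →
    transversal⇔whirlBasis 1≤m (image rotate B)
      ⇔-∘ (transversal-image rotate rotate-interval ⇔-∘ necklaceBasis⇔transversal B)

proposition6p1 : (n : ℕ) → 3 ≤ n → NecklaceIsoWhirl n
proposition6p1 (suc m) (s≤s 2≤m) = Wheel.necklace≅whirl m (≤-trans (s≤s z≤n) 2≤m)
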